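{- Let $M$ be a positive integer and let $\mathbf{v}=v_0v_1\cdots$ be defined by $v_n=2^{\,n\bmod M}$ if $n\not\equiv-1\pmod M$ and $v_n=1-2^{M-1}$ otherwise. Let $\mathbf{u}=u_0u_1\cdots$ be any infinite binary word (letters in $\{0,1\}$), and define $\mathbf{w}=w_0w_1\cdots$ by $w_n=u_n\cdot 2^M+v_n$. Let $i\le j\le k$ and set $x=w_iw_{i+1}\cdots w_{j-1}$, $y=w_jw_{j+1}\cdots w_{k-1}$. If $\sum x=\sum y$, then $|x|\equiv|y|\pmod M$ and $\sum_{h=i}^{j-1}u_h=\sum_{h=j}^{k-1}u_h$.
   Context: For a finite word $x$ whose letters are integers, $\sum x$ denotes the sum of its letters. -}

module Defs where

open import Data.Nat as ℕ using (ℕ; zero; suc; _∸_; _%_; NonZero)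
open import Data.Integer as ℤ using (ℤ; +_; _-_)
open import Data.List using (List; []; _∷_; map)
import Data.List as L

Word : Set → Set
Word A = ℕ → A

-- The finite factor  a_i a_{i+1} ... a_{j-1}  (empty if j ≤ i),
-- i.e. the letters at positions i, i+1, ..., i + (j ∸ i) - 1.
factor : {A : Set} → Word A → ℕ → ℕ → List A
factor a i j = go i (j ∸ i)
  where
  go : ℕ → ℕ → List _
  go s zero    = []
  go s (suc n) = a s ∷ go (suc s) n

Σword : List ℤ → ℤ
Σword = L.foldr ℤ._+_ (+ 0)

Σwordℕ : List ℕ → ℕ
Σwordℕ = L.foldr ℕ._+_ 0

-- v_n = 2^(n mod M) if n ≢ -1 (mod M), and 1 - 2^(M-1) otherwise.
-- n ≡ -1 (mod M)  ⇔  (n + 1) mod M = 0.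
v : (M : ℕ) → .{{_ : NonZero M}} → Word ℤ
v M n with (suc n) % M
... | zero  = + 1 - + (2 ℕ.^ (M ∸ 1))
... | suc _ = + (2 ℕ.^ (n % M))

w : (M : ℕ) → .{{_ : NonZero M}} → Word ℕ → Word ℤ
w M u n = + (u n ℕ.* 2 ℕ.^ M) ℤ.+ v M n

module Submission where

-- Write P = 2^M and A_s = 2^(s mod M).  The letters of v are
-- chosen so that v_s + A_s = A_(s+1) for every s, hence the sums of factors
-- of w telescope:
--     Σ w[s, s+n) + A_s  =  P · Σ u[s, s+n) + A_(s+n)            (telescope)
-- Applying this to x = w[i,j) and y = w[j,k), the hypothesis Σ x = Σ y becomes
--     P · Σ u[i,j) + (A_j + A_j)  =  P · Σ u[j,k) + (A_i + A_k)   (balance)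
-- in ℕ.  Every A_s lies in [1, P/2], so both "remainders" lie in (0, P]; the
-- representation  P·q + r  with 0 < r ≤ P is unique, which gives the equality
-- of the u-sums and A_j + A_j = A_i + A_k.  A power of two is a sum of two
-- powers of two only as a double, so i, j, k are congruent modulo M, i.e.
-- |x| = j - i and |y| = k - j are both divisible by M.

open import Defs
open import Data.Nat as ℕ
  using (ℕ; zero; suc; _+_; _*_; _^_; _∸_; _%_; _/_; NonZero; _≤_; _<_; s≤s; z≤n)
open import Data.Nat.Properties as ℕP using ()
open import Data.Nat.DivMod
  using (m≡m%n+[m/n]*n; [m+kn]%n≡m%n; m<n⇒m%n≡m; n%n≡0; m%n<n; %-pred-≡0)
open import Data.Nat.Divisibility using (_∣_; n∣m*n; ∣m+n∣m⇒∣n; n∣m⇒m%n≡0)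
open import Data.Integer as ℤ using (ℤ; +_; _-_)
import Data.Integer.Properties as ℤP
open import Data.Integer.Tactic.RingSolver using (solve-∀)
open import Data.List using ([]; _∷_; length)
open import Data.Product using (_×_; _,_; proj₁; proj₂)
open import Data.Sum using (inj₁; inj₂)
open import Data.Empty using (⊥-elim)
open import Relation.Nullary using (¬_)
open import Relation.Binary.Definitions using (tri<; tri≈; tri>)
open import Relation.Binary.PropositionalEquality

factor-empty : {A : Set} (a : Word A) (s : ℕ) → factor a s s ≡ []
factor-empty a s rewrite ℕP.n∸n≡0 s = refl

factor-cons : {A : Set} (a : Word A) (s n : ℕ) →
  factor a s (s + suc n) ≡ a s ∷ factor a (suc s) (suc s + n)
factor-cons a s n rewrite ℕP.m+n∸m≡n s (suc n) | ℕP.m+n∸m≡n s n = refl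

length-factor : {A : Set} (a : Word A) (s n : ℕ) → length (factor a s (s + n)) ≡ n
length-factor a s zero    rewrite ℕP.+-identityʳ s | factor-empty a s = refl
length-factor a s (suc n) rewrite factor-cons a s n = cong suc (length-factor a (suc s) n)

suc-%-reduce : ∀ s M .{{_ : NonZero M}} → suc s % M ≡ suc (s % M) % M
suc-%-reduce s M = begin
  suc s % M                         ≡⟨ cong (λ t → suc t % M) (m≡m%n+[m/n]*n s M) ⟩
  (suc (s % M) + s / M * M) % M     ≡⟨ [m+kn]%n≡m%n (suc (s % M)) (s / M) M ⟩
  suc (s % M) % M                   ∎
  where open ≡-Reasoning

suc-% : ∀ s M .{{_ : NonZero M}} → ¬ (suc s % M ≡ 0) → suc s % M ≡ suc (s % M)
suc-% s M s+1≢0 with ℕP.m≤n⇒m<n∨m≡n (m%n<n s M)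
... | inj₁ lt = trans (suc-%-reduce s M) (m<n⇒m%n≡m lt)
... | inj₂ eq = ⊥-elim (s+1≢0 (trans (suc-%-reduce s M) (trans (cong (_% M) eq) (n%n≡0 M))))

%-cancel-+ˡ : ∀ i d M .{{_ : NonZero M}} → (i + d) % M ≡ i % M → d % M ≡ 0
%-cancel-+ˡ i d M same = n∣m⇒m%n≡0 d M (∣m+n∣m⇒∣n (subst (M ∣_) quotients (n∣m*n ((i + d) / M))) (n∣m*n (i / M)))
  where
  open ≡-Reasoning
  quotients : (i + d) / M * M ≡ i / M * M + d
  quotients = ℕP.+-cancelˡ-≡ (i % M) _ _ (begin
    i % M + (i + d) / M * M          ≡⟨ cong (_+ (i + d) / M * M) (sym same) ⟩
    (i + d) % M + (i + d) / M * M    ≡⟨ sym (m≡m%n+[m/n]*n (i + d) M) ⟩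
    i + d                            ≡⟨ cong (_+ d) (m≡m%n+[m/n]*n i M) ⟩
    i % M + i / M * M + d            ≡⟨ ℕP.+-assoc (i % M) _ d ⟩
    i % M + (i / M * M + d)          ∎)

-- Division with remainder in (0, P] is unique: the remainder is never 0, so
-- comparing quotients by induction never meets a carry.
quotient-remainder-unique : ∀ P {q₁ q₂ r₁ r₂} →
  0 < r₁ → r₁ ≤ P → 0 < r₂ → r₂ ≤ P →
  P * q₁ + r₁ ≡ P * q₂ + r₂ → q₁ ≡ q₂ × r₁ ≡ r₂
quotient-remainder-unique P {zero} {zero} _ _ _ _ eq
  rewrite ℕP.*-zeroʳ P = refl , eq
quotient-remainder-unique P {suc q₁} {suc q₂} {r₁} {r₂} r₁>0 r₁≤P r₂>0 r₂≤P eq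
  with quotient-remainder-unique P r₁>0 r₁≤P r₂>0 r₂≤P (ℕP.+-cancelˡ-≡ P _ _ (begin
    P + (P * q₁ + r₁)   ≡⟨ sym (ℕP.+-assoc P _ r₁) ⟩
    P + P * q₁ + r₁     ≡⟨ cong (_+ r₁) (sym (ℕP.*-suc P q₁)) ⟩
    P * suc q₁ + r₁     ≡⟨ eq ⟩
    P * suc q₂ + r₂     ≡⟨ cong (_+ r₂) (ℕP.*-suc P q₂) ⟩
    P + P * q₂ + r₂     ≡⟨ ℕP.+-assoc P _ r₂ ⟩
    P + (P * q₂ + r₂)   ∎))
  where open ≡-Reasoning
... | q₁≡q₂ , r₁≡r₂ = cong suc q₁≡q₂ , r₁≡r₂
quotient-remainder-unique P {zero} {suc q₂} _ r₁≤P r₂>0 _ eq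
  rewrite ℕP.*-zeroʳ P = ⊥-elim (ℕP.<⇒≱ (exceeds-modulus P q₂ r₂>0) (ℕP.≤-trans (ℕP.≤-reflexive (sym eq)) r₁≤P))
  where
  exceeds-modulus : ∀ N q {r} → 0 < r → N < N * suc q + r
  exceeds-modulus N q r>0 rewrite ℕP.*-suc N q =
    ℕP.<-≤-trans (ℕP.m<m+n N r>0) (ℕP.+-monoˡ-≤ _ (ℕP.m≤m+n N (N * q)))
quotient-remainder-unique P {suc q₁} {zero} r₁>0 r₁≤P r₂>0 r₂≤P eq
  with quotient-remainder-unique P {zero} {suc q₁} r₂>0 r₂≤P r₁>0 r₁≤P (sym eq)
... | () , _

1<2 : 1 < 2
1<2 = s≤s (s≤s z≤n)

2^-double : ∀ a → 2 ^ a + 2 ^ a ≡ 2 ^ suc a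
2^-double a = cong (λ t → 2 ^ a + t) (sym (ℕP.+-identityʳ _))

2^-cancel-< : ∀ a b → 2 ^ a < 2 ^ b → a < b
2^-cancel-< a b 2^a<2^b with ℕP.<-cmp a b
... | tri< a<b _ _ = a<b
... | tri≈ _ refl _ = ⊥-elim (ℕP.<-irrefl refl 2^a<2^b)
... | tri> _ _ a>b = ⊥-elim (ℕP.<-asym 2^a<2^b (ℕP.^-monoʳ-< 2 1<2 a>b))

2^-injective : ∀ a b → 2 ^ a ≡ 2 ^ b → a ≡ b
2^-injective a b eq with ℕP.<-cmp a b
... | tri< a<b _ _ = ⊥-elim (ℕP.<-irrefl eq (ℕP.^-monoʳ-< 2 1<2 a<b))
... | tri≈ _ a≡b _ = a≡b
... | tri> _ _ a>b = ⊥-elim (ℕP.<-irrefl (sym eq) (ℕP.^-monoʳ-< 2 1<2 a>b))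

-- For a < c the sum 2^a + 2^c lies strictly between 2^c and 2^(c+1),
-- so it is not a power of two.
distinct-powers-sum : ∀ a c e → a < c → ¬ (2 ^ a + 2 ^ c ≡ 2 ^ e)
distinct-powers-sum a c e a<c sum≡2^e = ℕP.<-irrefl refl (ℕP.<-≤-trans c<e (ℕP.≤-pred e<c+1))
  where
  c<e : c < e
  c<e = 2^-cancel-< c e (ℕP.<-≤-trans (ℕP.m<n+m (2 ^ c) (ℕP.m^n>0 2 a)) (ℕP.≤-reflexive sum≡2^e))
  e<c+1 : e < suc c
  e<c+1 = 2^-cancel-< e (suc c) (begin-strict
    2 ^ e           ≡⟨ sym sum≡2^e ⟩
    2 ^ a + 2 ^ c   <⟨ ℕP.+-monoˡ-< (2 ^ c) (ℕP.^-monoʳ-< 2 1<2 a<c) ⟩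
    2 ^ c + 2 ^ c   ≡⟨ 2^-double c ⟩
    2 ^ suc c       ∎)
    where open ℕP.≤-Reasoning

powers-sum-double : ∀ a b c → 2 ^ a + 2 ^ c ≡ 2 ^ b + 2 ^ b → a ≡ b × c ≡ b
powers-sum-double a b c eq with ℕP.<-cmp a c
... | tri< a<c _ _ = ⊥-elim (distinct-powers-sum a c (suc b) a<c (trans eq (2^-double b)))
... | tri> _ _ a>c = ⊥-elim (distinct-powers-sum c a (suc b) a>c
                       (trans (ℕP.+-comm (2 ^ c) (2 ^ a)) (trans eq (2^-double b))))
... | tri≈ _ refl _ = a≡b , a≡b
  where
  a≡b : a ≡ b
  a≡b = ℕP.suc-injective (2^-injective (suc a) (suc b)
          (trans (sym (2^-double a)) (trans eq (2^-double b))))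

v-step : ∀ M .{{_ : NonZero M}} s → v M s ℤ.+ + (2 ^ (s % M)) ≡ + (2 ^ (suc s % M))
v-step M s with suc s % M in s+1%M
... | zero rewrite %-pred-≡0 {s} {M} s+1%M = cancel (+ 1) (+ (2 ^ (M ∸ 1)))
  where
  cancel : ∀ a b → a - b ℤ.+ b ≡ a
  cancel = solve-∀
... | suc r rewrite ℕP.suc-injective (trans (sym s+1%M) (suc-% s M (λ z → ℕP.0≢1+n (trans (sym z) s+1%M)))) =
  trans (sym (ℤP.pos-+ (2 ^ (s % M)) _)) (cong +_ (2^-double (s % M)))

telescope : ∀ M .{{_ : NonZero M}} (u : Word ℕ) s n →
  Σword (factor (w M u) s (s + n)) ℤ.+ + (2 ^ (s % M))
    ≡ + (2 ^ M * Σwordℕ (factor u s (s + n))) ℤ.+ + (2 ^ ((s + n) % M))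
telescope M u s zero
  rewrite ℕP.+-identityʳ s | factor-empty (w M u) s | factor-empty u s | ℕP.*-zeroʳ (2 ^ M) = refl
telescope M u s (suc n) rewrite factor-cons (w M u) s n | factor-cons u s n | ℕP.+-suc s n = begin
  (+ (u s * P) ℤ.+ v M s ℤ.+ Sw) ℤ.+ + (2 ^ (s % M))   ≡⟨ regroup (+ (u s * P)) (v M s) Sw _ ⟩
  + (u s * P) ℤ.+ (Sw ℤ.+ (v M s ℤ.+ + (2 ^ (s % M)))) ≡⟨ cong (λ z → + (u s * P) ℤ.+ (Sw ℤ.+ z)) (v-step M s) ⟩
  + (u s * P) ℤ.+ (Sw ℤ.+ + (2 ^ (suc s % M)))         ≡⟨ cong (λ z → + (u s * P) ℤ.+ z) (telescope M u (suc s) n) ⟩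
  + (u s * P) ℤ.+ (+ (P * Su) ℤ.+ C)                   ≡⟨ sym (ℤP.+-assoc (+ (u s * P)) (+ (P * Su)) C) ⟩
  (+ (u s * P) ℤ.+ + (P * Su)) ℤ.+ C                   ≡⟨ cong (ℤ._+ C) (sym (ℤP.pos-+ (u s * P) _)) ⟩
  + (u s * P + P * Su) ℤ.+ C                           ≡⟨ cong (λ z → + z ℤ.+ C) factor-out-P ⟩
  + (P * (u s + Su)) ℤ.+ C                             ∎
  where
  open ≡-Reasoning
  P Su : ℕ
  P  = 2 ^ M
  Su = Σwordℕ (factor u (suc s) (suc s + n))
  Sw C : ℤ
  Sw = Σword (factor (w M u) (suc s) (suc s + n))
  C  = + (2 ^ (suc (s + n) % M))
  regroup : ∀ a b c d → (a ℤ.+ b ℤ.+ c) ℤ.+ d ≡ a ℤ.+ (c ℤ.+ (b ℤ.+ d))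
  regroup = solve-∀
  factor-out-P : u s * P + P * Su ≡ P * (u s + Su)
  factor-out-P = trans (cong (_+ P * Su) (ℕP.*-comm (u s) P)) (sym (ℕP.*-distribˡ-+ P (u s) Su))

balance : ∀ M .{{_ : NonZero M}} (u : Word ℕ) i d₁ d₂ →
  let j = i + d₁; k = j + d₂ in
  Σword (factor (w M u) i j) ≡ Σword (factor (w M u) j k) →
  2 ^ M * Σwordℕ (factor u i j) + (2 ^ (j % M) + 2 ^ (j % M))
    ≡ 2 ^ M * Σwordℕ (factor u j k) + (2 ^ (i % M) + 2 ^ (k % M))
balance M u i d₁ d₂ sums≡ = ℤP.+-injective (begin
  + (P * U₁ + (B + B))              ≡⟨ to-ℤ (P * U₁) B B ⟩
  (+ (P * U₁) ℤ.+ + B) ℤ.+ + B      ≡⟨ cong (ℤ._+ + B) (sym (telescope M u i d₁)) ⟩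
  (S₁ ℤ.+ + A) ℤ.+ + B              ≡⟨ cong (λ z → (z ℤ.+ + A) ℤ.+ + B) sums≡ ⟩
  (S₂ ℤ.+ + A) ℤ.+ + B              ≡⟨ swap S₂ (+ A) (+ B) ⟩
  (S₂ ℤ.+ + B) ℤ.+ + A              ≡⟨ cong (ℤ._+ + A) (telescope M u j d₂) ⟩
  (+ (P * U₂) ℤ.+ + C) ℤ.+ + A      ≡⟨ sym (to-ℤ (P * U₂) A C) ⟩
  + (P * U₂ + (A + C))              ∎)
  where
  open ≡-Reasoning
  j k P A B C U₁ U₂ : ℕ
  j = i + d₁
  k = j + d₂
  P = 2 ^ M
  A = 2 ^ (i % M)
  B = 2 ^ (j % M)
  C = 2 ^ (k % M)
  S₁ S₂ : ℤ
  S₁ = Σword (factor (w M u) i j)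
  S₂ = Σword (factor (w M u) j k)
  U₁ = Σwordℕ (factor u i j)
  U₂ = Σwordℕ (factor u j k)
  swap : ∀ x y z → (x ℤ.+ y) ℤ.+ z ≡ (x ℤ.+ z) ℤ.+ y
  swap = solve-∀
  to-ℤ : ∀ p a c → + (p + (a + c)) ≡ (+ p ℤ.+ + c) ℤ.+ + a
  to-ℤ p a c rewrite ℤP.pos-+ p (a + c) | ℤP.pos-+ a c = regroup (+ p) (+ a) (+ c)
    where
    regroup : ∀ x y z → x ℤ.+ (y ℤ.+ z) ≡ (x ℤ.+ z) ℤ.+ y
    regroup = solve-∀

-- 2^(s mod M) ≤ 2^(M-1), so two such powers sum to at most 2^M: both sides
-- of the balance identity have remainders in (0, 2^M].
power-bound : ∀ m s → 2 ^ (s % suc m) ≤ 2 ^ m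
power-bound m s = ℕP.^-monoʳ-≤ 2 (ℕP.≤-pred (m%n<n s (suc m)))

two-powers-bound : ∀ m a b → 2 ^ (a % suc m) + 2 ^ (b % suc m) ≤ 2 ^ suc m
two-powers-bound m a b =
  ℕP.≤-trans (ℕP.+-mono-≤ (power-bound m a) (power-bound m b)) (ℕP.≤-reflexive (2^-double m))

positive-sum : ∀ a b → 0 < 2 ^ a + 2 ^ b
positive-sum a b = ℕP.<-≤-trans (ℕP.m^n>0 2 a) (ℕP.m≤m+n (2 ^ a) (2 ^ b))

mainTheorem14 : (M : ℕ) → .{{_ : NonZero M}} →
    (u : Word ℕ) → (∀ n → u n < 2) →
    (i j k : ℕ) → i ≤ j → j ≤ k →
    Σword (factor (w M u) i j) ≡ Σword (factor (w M u) j k) →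
    (length (factor (w M u) i j) % M ≡ length (factor (w M u) j k) % M)
    × (Σwordℕ (factor u i j) ≡ Σwordℕ (factor u j k))
mainTheorem14 M@(suc m) u _ i j k i≤j j≤k sums≡
  with ℕP.m≤n⇒∃[o]m+o≡n i≤j | ℕP.m≤n⇒∃[o]m+o≡n j≤k
... | d₁ , refl | d₂ , refl = lengths , proj₁ digits
  where
  U₁ U₂ : ℕ
  U₁ = Σwordℕ (factor u i j)
  U₂ = Σwordℕ (factor u j k)
  digits : U₁ ≡ U₂ × 2 ^ (j % M) + 2 ^ (j % M) ≡ 2 ^ (i % M) + 2 ^ (k % M)
  digits = quotient-remainder-unique (2 ^ M)
             (positive-sum (j % M) (j % M)) (two-powers-bound m j j)
             (positive-sum (i % M) (k % M)) (two-powers-bound m i k)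
             (balance M u i d₁ d₂ sums≡)
  residues : i % M ≡ j % M × k % M ≡ j % M
  residues = powers-sum-double (i % M) (j % M) (k % M) (sym (proj₂ digits))
  lengths : length (factor (w M u) i j) % M ≡ length (factor (w M u) j k) % M
  lengths rewrite length-factor (w M u) i d₁ | length-factor (w M u) j d₂ =
    trans (%-cancel-+ˡ i d₁ M (sym (proj₁ residues))) (sym (%-cancel-+ˡ j d₂ M (proj₂ residues)))
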